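{- Let $L$ be the graph with vertices $o_1,o_2,o_3,o_4,p_1,p_2,p_3,p_4$ and edges $o_io_{i+1}$, $p_ip_{i+1}$, $o_ip_i$, $o_{i+1}p_i$ for $i=1,\dots,4$ (indices modulo 4), with outer 4-cycle $o_1o_2o_3o_4$ and inner 4-cycle $p_1p_2p_3p_4$. Let $M$ be the $4\times 4$ matrix of polynomials whose $(i,j)$ entry is the number of proper $x$-colourings of $L$ that are of type $i$ on the outer 4-cycle and of type $j$ on the inner 4-cycle. Let $A$ be a graph with distinguished 4-cycle $a_1a_2a_3a_4$, and let $A'$ be the graph obtained from the disjoint union of $A$ and $L$ by identifying $a_i$ with $p_i$ for $1\le i\le 4$, with distinguished 4-cycle $o_1o_2o_3o_4$. Then $$Q(A',x)=M\,D\,Q(A,x),$$ where $D=\mathrm{diag}\big(1/x^{\underline 2},\,1/x^{\underline 3},\,1/x^{\underline 3},\,1/x^{\underline 4}\big)$.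
   Context: For a graph $A$ with a distinguished 4-cycle $a_1a_2a_3a_4$ (vertices listed in cyclic order) and a positive integer $x$, a proper $x$-colouring $\varphi$ of $A$ has type 1 (on that cycle) if $\varphi(a_1)=\varphi(a_3)$ and $\varphi(a_2)=\varphi(a_4)$; type 2 if $\varphi(a_1)=\varphi(a_3)$ and $\varphi(a_2)\ne\varphi(a_4)$; type 3 if $\varphi(a_1)\ne\varphi(a_3)$ and $\varphi(a_2)=\varphi(a_4)$; type 4 if $\varphi(a_1)\ne\varphi(a_3)$ and $\varphi(a_2)\ne\varphi(a_4)$. $P_i(A,x)$ denotes the number of proper $x$-colourings of $A$ of type $i$; it is a polynomial in $x$ and is regarded as such (likewise the entries of $M$ are polynomials in $x$). The partitioned chromatic polynomial is $Q(A,x)=(P_1(A,x),P_2(A,x),P_3(A,x),P_4(A,x))^T$. The falling factorial is $x^{\underline k}=x(x-1)\cdots(x-k+1)$. Multiple edges created by identification are merged. -}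

module Defs where

open import Data.Nat using (ℕ; zero; suc; _*_; _∸_)
open import Data.Bool using (Bool; true; false; _∧_; _∨_; not; if_then_else_)
open import Data.Fin using (Fin; zero; suc; _↑ˡ_; _↑ʳ_; splitAt; _≟_)
open import Data.Sum using (_⊎_; inj₁; inj₂)
open import Data.Product using (_×_; _,_)
open import Data.List using (List; []; _∷_; map; allFin; concatMap)
open import Data.Nat.ListAction using (sum)
open import Data.Bool.ListAction using (all; any)
open import Relation.Nullary.Decidable using (⌊_⌋)

-- Finite graphs: vertex set Fin n, adjacency given as a Bool-valued
-- relation (simple graphs: symmetric, irreflexive; imposed in the theorem).

-- Falling factorial x^{\underline k} = x (x-1) ... (x-k+1)  (truncated
-- subtraction is harmless: the product hits the factor 0 when x < k).
ff : ℕ → ℕ → ℕ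
ff x zero    = 1
ff x (suc k) = ff x k * (x ∸ k)

next : Fin 4 → Fin 4
next zero                   = suc zero
next (suc zero)             = suc (suc zero)
next (suc (suc zero))       = suc (suc (suc zero))
next (suc (suc (suc zero))) = zero

extend : ∀ {n x} → Fin x → (Fin n → Fin x) → (Fin (suc n) → Fin x)
extend c f zero    = c
extend c f (suc i) = f i

countMaps : (n x : ℕ) → ((Fin n → Fin x) → Bool) → ℕ
countMaps zero    x P = if P (λ ()) then 1 else 0
countMaps (suc n) x P =
  sum (map (λ c → countMaps n x (λ f → P (extend c f))) (allFin x))

isProper : (n : ℕ) → (Fin n → Fin n → Bool) → ∀ {x} → (Fin n → Fin x) → Bool
isProper n adj f =
  all (λ u → all (λ v → not (adj u v ∧ ⌊ f u ≟ f v ⌋)) (allFin n)) (allFin n)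

-- Types on a 4-cycle c 0, c 1, c 2, c 3 (cyclic order).
-- Type t ∈ Fin 4 here corresponds to the paper's type t+1:
--   zero ↦ type 1, suc zero ↦ type 2, 2 ↦ type 3, 3 ↦ type 4.
hasType : ∀ {n x} → Fin 4 → (Fin 4 → Fin n) → (Fin n → Fin x) → Bool
hasType t c f = match t e13 e24
  where
  e13 = ⌊ f (c zero) ≟ f (c (suc (suc zero))) ⌋
  e24 = ⌊ f (c (suc zero)) ≟ f (c (suc (suc (suc zero)))) ⌋
  match : Fin 4 → Bool → Bool → Bool
  match zero                   a b = a ∧ b
  match (suc zero)             a b = a ∧ not b
  match (suc (suc zero))       a b = not a ∧ b
  match (suc (suc (suc zero))) a b = not a ∧ not b

P : (n : ℕ) → (Fin n → Fin n → Bool) → (Fin 4 → Fin n) → (x : ℕ) → Fin 4 → ℕ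
P n adj c x t = countMaps n x (λ f → isProper n adj f ∧ hasType t c f)

-- The graph L on Fin 8: o_i = i ↑ˡ 4 (vertices 0..3), p_i = 4 ↑ʳ i (4..7).

oL : Fin 4 → Fin 8
oL i = i ↑ˡ 4

pL : Fin 4 → Fin 8
pL i = 4 ↑ʳ i

edgesL : List (Fin 8 × Fin 8)
edgesL = concatMap
  (λ i → (oL i , oL (next i)) ∷ (pL i , pL (next i)) ∷ (oL i , pL i)
         ∷ (oL (next i) , pL i) ∷ [])
  (allFin 4)

adjOf : ∀ {m} → List (Fin m × Fin m) → Fin m → Fin m → Bool
adjOf es u v = any (λ { (a , b) → (⌊ a ≟ u ⌋ ∧ ⌊ b ≟ v ⌋) ∨ (⌊ a ≟ v ⌋ ∧ ⌊ b ≟ u ⌋) }) es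

adjL : Fin 8 → Fin 8 → Bool
adjL = adjOf edgesL

M : (x : ℕ) → Fin 4 → Fin 4 → ℕ
M x i j = countMaps 8 x (λ f → isProper 8 adjL f ∧ hasType i oL f ∧ hasType j pL f)

-- Vertex set Fin (n + 4): a vertex u ↑ˡ 4 is the vertex u of A,
-- n ↑ʳ i is o_i.

glue : ∀ {n} → (Fin 4 → Fin n) → Fin 8 → Fin (n Data.Nat.+ 4)
glue {n} a l with splitAt 4 l
... | inj₁ i = n ↑ʳ i
... | inj₂ i = a i ↑ˡ 4

adjA' : (n : ℕ) → (Fin n → Fin n → Bool) → (Fin 4 → Fin n) →
        Fin (n Data.Nat.+ 4) → Fin (n Data.Nat.+ 4) → Bool
adjA' n adj a u v = fromA (splitAt n u) (splitAt n v) ∨ fromL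
  where
  fromA : Fin n ⊎ Fin 4 → Fin n ⊎ Fin 4 → Bool
  fromA (inj₁ x) (inj₁ y) = adj x y
  fromA _        _        = false
  fromL : Bool
  fromL = any (λ { (l , l') → adjL l l' ∧ ⌊ glue a l ≟ u ⌋ ∧ ⌊ glue a l' ≟ v ⌋ })
              (concatMap (λ l → map (λ l' → (l , l')) (allFin 8)) (allFin 8))

cycA' : (n : ℕ) → Fin 4 → Fin (n Data.Nat.+ 4)
cycA' n i = n ↑ʳ i

-- D = diag(1/x^{2}, 1/x^{3}, 1/x^{3}, 1/x^{4}) (falling factorials).
-- dd t x is the denominator of the t-th diagonal entry.
dd : Fin 4 → ℕ → ℕ
dd zero                   x = ff x 2
dd (suc zero)             x = ff x 3
dd (suc (suc zero))       x = ff x 3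
dd (suc (suc (suc zero))) x = ff x 4

ddAll : ℕ → ℕ
ddAll x = dd zero x * dd (suc zero) x * dd (suc (suc zero)) x * dd (suc (suc (suc zero))) x

ddOther : Fin 4 → ℕ → ℕ
ddOther zero                   x = dd (suc zero) x * dd (suc (suc zero)) x * dd (suc (suc (suc zero))) x
ddOther (suc zero)             x = dd zero x * dd (suc (suc zero)) x * dd (suc (suc (suc zero))) x
ddOther (suc (suc zero))       x = dd zero x * dd (suc zero) x * dd (suc (suc (suc zero))) x
ddOther (suc (suc (suc zero))) x = dd zero x * dd (suc zero) x * dd (suc (suc zero)) x

{-# OPTIONS --safe #-}
-- Split a colouring of A' into its restriction f to A and the colours g of o₁ … o₄. It is
-- proper exactly when f is proper on A and g together with f ∘ a is proper on L, so
-- P_i(A') = Σ_f [f proper] E_i(f ∘ a), where E_i(q) counts the type-i colourings of the outer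
-- cycle of L extending the colouring q of the inner cycle. E_i(q) vanishes unless q properly
-- colours the 4-cycle, and then depends only on the type j of q, because two such colourings of
-- the same type differ by a permutation of the colours. Hence C_j Σ_{f of type j} E_i(f ∘ a)
-- = M_ij P_j(A), where C_j counts the proper colourings of the 4-cycle of type j. Substituting
-- the equalities forced by the type, these are tuples of 2, 3, 3 or 4 distinct colours, so C_j
-- is the j-th denominator of D.
module Submission where

open import Defs
open import Data.Nat using (ℕ; _*_; _+_)
open import Data.Bool using (Bool; true; false)
open import Data.Fin using (Fin)
open import Data.List using (map; allFin)
open import Data.Nat.ListAction using (sum)
open import Function.Definitions using (Injective)
open import Relation.Binary.PropositionalEquality using (_≡_)

import Algebra.Solver.IdempotentCommutativeMonoid as ∧-Solver
open import Data.Bool using (_∧_; _∨_; not; if_then_else_)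
open import Data.Bool.ListAction using (all; and; any)
open import Data.Bool.Properties
  using (∧-assoc; ∧-zeroʳ; ∧-identityʳ; ∧-idempotentCommutativeMonoid; T-≡; ⇔→≡)
open import Data.Fin using (zero; suc; _≟_; _↑ˡ_; splitAt)
open import Data.Fin.Permutation as Perm using (Permutation′; _⟨$⟩ʳ_; _⟨$⟩ˡ_; _∘ₚ_)
import Data.Fin.Permutation.Components as PC
open import Data.Fin.Properties using (any?; splitAt-↑ˡ; splitAt⁻¹-↑ˡ)
open import Data.List using (List; tabulate; concatMap)
open import Data.List.Membership.Propositional using (_∈_; lose)
open import Data.List.Membership.Propositional.Properties using (∈-allFin; ∈-map⁺; ∈-concatMap⁺)
open import Data.List.Properties using (map-cong)
open import Data.List.Relation.Unary.All as All using ()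
open import Data.List.Relation.Unary.All.Properties using (all⁺; all⁻)
open import Data.List.Relation.Unary.Any using (satisfied)
open import Data.List.Relation.Unary.Any.Properties using (any⁺; any⁻)
open import Data.Nat using (zero; suc; _∸_)
open import Data.Nat.Properties
  using (+-*-semiring; +-comm; +-identityʳ; *-comm; *-assoc; *-identityˡ; *-identityʳ; *-zeroʳ;
         m+n∸m≡n; ∸-+-assoc)
open import Algebra.Properties.Semiring.Sum +-*-semiring
  using (sum-syntax; sum-cong-≗; sum-replicate-zero; ∑-distrib-+; ∑-comm; ∑-permute; *-distribˡ-sum)
  renaming (sum to ∑)
open import Data.Nat.Tactic.RingSolver using (solve-∀)
open import Data.Product using (_×_; _,_; proj₁; proj₂; ∃-syntax)
open import Data.Sum using (_⊎_; inj₁; inj₂; [_,_]′)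
open import Data.Vec.Functional using (_++_; _∷_; [])
open import Data.Vec.Functional.Properties using (lookup-++ˡ; lookup-++ʳ; ++-cong)
open import Function using (_∘_; id; _⇔_; mk⇔; Equivalence)
open import Relation.Binary.Core using (_Preserves_⟶_)
open import Relation.Binary.PropositionalEquality
  using (_≢_; _≗_; refl; sym; trans; cong; cong₂; module ≡-Reasoning)
open import Relation.Nullary.Decidable using (⌊_⌋; yes; no; ⌊⌋-map′; dec-true; dec-false)
open import Relation.Nullary.Negation using (contradiction)

pattern 0F = zero
pattern 1F = suc zero
pattern 2F = suc (suc zero)
pattern 3F = suc (suc (suc zero))

𝟙 : Bool → ℕ
𝟙 b = if b then 1 else 0

𝟙-∧ : ∀ a b → 𝟙 (a ∧ b) ≡ 𝟙 a * 𝟙 b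
𝟙-∧ true  b = sym (*-identityˡ (𝟙 b))
𝟙-∧ false b = refl

𝟙-∧-assoc : ∀ a b c → 𝟙 ((a ∧ b) ∧ c) ≡ 𝟙 a * 𝟙 (b ∧ c)
𝟙-∧-assoc a b c = trans (cong 𝟙 (∧-assoc a b c)) (𝟙-∧ a (b ∧ c))

𝟙-∧-swap : ∀ a b c → 𝟙 (a ∧ (b ∧ c)) ≡ 𝟙 c * 𝟙 (a ∧ b)
𝟙-∧-swap true  true  c = sym (*-identityʳ (𝟙 c))
𝟙-∧-swap true  false c = sym (*-zeroʳ (𝟙 c))
𝟙-∧-swap false b     c = sym (*-zeroʳ (𝟙 c))

𝟙-∧-false : ∀ a b → 𝟙 (a ∧ (b ∧ false)) ≡ 0
𝟙-∧-false a b rewrite ∧-zeroʳ b | ∧-zeroʳ a = refl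

𝟙-exchange : ∀ c p {e₁ e₂} → (c ≡ true → p ≡ true → e₁ ≡ e₂) → 𝟙 c * (𝟙 p * e₁) ≡ 𝟙 c * e₂ * 𝟙 p
𝟙-exchange false p     _ = refl
𝟙-exchange true  false {e₂ = e₂} _ = sym (*-zeroʳ (1 * e₂))
𝟙-exchange true  true {e₁} {e₂} e₁≡e₂ = begin
  1 * (1 * e₁) ≡⟨ trans (*-identityˡ (1 * e₁)) (*-identityˡ e₁) ⟩
  e₁           ≡⟨ e₁≡e₂ refl refl ⟩
  e₂           ≡⟨ trans (*-identityʳ (1 * e₂)) (*-identityˡ e₂) ⟨
  1 * e₂ * 1   ∎
  where open ≡-Reasoning

∧-≡-true : ∀ {a b} → a ∧ b ≡ true ⇔ (a ≡ true × b ≡ true)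
∧-≡-true {true}  = mk⇔ (refl ,_) proj₂
∧-≡-true {false} = mk⇔ (λ ()) (λ ())

∨-≡-true : ∀ {a b} → a ∨ b ≡ true ⇔ (a ≡ true ⊎ b ≡ true)
∨-≡-true {true}  = mk⇔ inj₁ (λ _ → refl)
∨-≡-true {false} = mk⇔ inj₂ [ (λ ()) , id ]′

all-allFin : ∀ {n} (p : Fin n → Bool) → all p (allFin n) ≡ true ⇔ (∀ i → p i ≡ true)
all-allFin p = mk⇔
  (λ all≡true i → Equivalence.to T-≡
    (All.lookup (all⁺ p (allFin _) (Equivalence.from T-≡ all≡true)) (∈-allFin i)))
  (λ p≡true → Equivalence.to T-≡ (all⁻ p {allFin _} (All.tabulate λ {i} _ → Equivalence.from T-≡ (p≡true i))))

module _ {x : ℕ} where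

  ⌊≟⌋-true : {a b : Fin x} → a ≡ b → ⌊ a ≟ b ⌋ ≡ true
  ⌊≟⌋-true {a} {b} a≡b with a ≟ b
  ... | yes _  = refl
  ... | no a≢b = contradiction a≡b a≢b

  ⌊≟⌋-false : {a b : Fin x} → a ≢ b → ⌊ a ≟ b ⌋ ≡ false
  ⌊≟⌋-false {a} {b} a≢b with a ≟ b
  ... | yes a≡b = contradiction a≡b a≢b
  ... | no _    = refl

  ⌊≟⌋-sound : {a b : Fin x} → ⌊ a ≟ b ⌋ ≡ true → a ≡ b
  ⌊≟⌋-sound {a} {b} eq with a ≟ b
  ... | yes a≡b = a≡b

  ⌊≟⌋-sym : (a b : Fin x) → ⌊ a ≟ b ⌋ ≡ ⌊ b ≟ a ⌋
  ⌊≟⌋-sym a b with a ≟ b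
  ... | yes a≡b = sym (⌊≟⌋-true (sym a≡b))
  ... | no a≢b  = sym (⌊≟⌋-false (a≢b ∘ sym))

  not⌊≟⌋⇔≢ : {u v : Fin x} → not ⌊ u ≟ v ⌋ ≡ true ⇔ u ≢ v
  not⌊≟⌋⇔≢ {u} {v} with u ≟ v
  ... | yes u≡v = mk⇔ (λ ()) (λ u≢v → contradiction u≡v u≢v)
  ... | no u≢v  = mk⇔ (λ _ → u≢v) (λ _ → refl)

sum-map-tabulate : ∀ {A : Set} {x} (G : A → ℕ) (h : Fin x → A) →
                   sum (map G (tabulate h)) ≡ ∑[ c < x ] G (h c)
sum-map-tabulate {x = zero}  G h = refl
sum-map-tabulate {x = suc x} G h = cong (G (h zero) +_) (sum-map-tabulate G (h ∘ suc))

∑-one : ∀ x → ∑[ c < x ] 1 ≡ x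
∑-one zero    = refl
∑-one (suc x) = cong suc (∑-one x)

∑-point : ∀ {x} (a : Fin x) (G : Fin x → ℕ) → ∑[ c < x ] (𝟙 ⌊ c ≟ a ⌋ * G c) ≡ G a
∑-point {suc x} zero G = begin
  1 * G zero + ∑[ c < x ] (0 * G (suc c))  ≡⟨ cong₂ _+_ (*-identityˡ (G zero)) (sum-replicate-zero x) ⟩
  G zero + 0                             ≡⟨ +-comm (G zero) 0 ⟩
  G zero                                 ∎
  where open ≡-Reasoning
∑-point {suc x} (suc a) G = trans
  (sum-cong-≗ (λ c → cong (λ b → 𝟙 b * G (suc c)) (⌊⌋-map′ (cong suc) _ (c ≟ a))))
  (∑-point a (G ∘ suc))

∑-avoid : ∀ {x} (a : Fin x) (G : Fin x → ℕ) →
          ∑[ c < x ] (𝟙 (not ⌊ c ≟ a ⌋) * G c) ≡ ∑[ c < x ] G c ∸ G a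
∑-avoid {x} a G = begin
  ∑[ c < x ] unequal c                    ≡⟨ m+n∸m≡n (G a) (∑[ c < x ] unequal c) ⟨
  G a + ∑[ c < x ] unequal c ∸ G a        ≡⟨ cong (λ s → s + ∑[ c < x ] unequal c ∸ G a) (∑-point a G) ⟨
  ∑[ c < x ] equal c + ∑[ c < x ] unequal c ∸ G a
                                          ≡⟨ cong (_∸ G a) (∑-distrib-+ equal unequal) ⟨
  ∑[ c < x ] (equal c + unequal c) ∸ G a  ≡⟨ cong (_∸ G a) (sum-cong-≗ (λ c → split ⌊ c ≟ a ⌋ (G c))) ⟩
  ∑[ c < x ] G c ∸ G a                    ∎
  where
  open ≡-Reasoning
  equal unequal : Fin x → ℕ
  equal   c = 𝟙 ⌊ c ≟ a ⌋ * G c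
  unequal c = 𝟙 (not ⌊ c ≟ a ⌋) * G c
  split : ∀ b g → 𝟙 b * g + 𝟙 (not b) * g ≡ g
  split true  g = trans (cong (_+ 0) (*-identityˡ g)) (+-comm g 0)
  split false g = *-identityˡ g

∑∑-point : ∀ {x} (a : Fin x) (G : Fin x → ℕ) →
           ∑[ c < x ] ∑[ d < x ] (𝟙 ⌊ c ≟ a ⌋ * G d) ≡ ∑[ d < x ] G d
∑∑-point {x} a G = trans (sum-cong-≗ (λ c → sym (*-distribˡ-sum (𝟙 ⌊ c ≟ a ⌋) G)))
                         (∑-point a (λ _ → ∑[ d < x ] G d))

sumMaps : (n x : ℕ) → ((Fin n → Fin x) → ℕ) → ℕ
sumMaps zero    x F = F (λ ())
sumMaps (suc n) x F = ∑[ c < x ] sumMaps n x (λ f → F (extend c f))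

infixl 10 sumMaps
syntax sumMaps n x (λ f → e) = ∑[ f ∶ n ⟶ x ] e

countMaps≡sumMaps : ∀ n x P → countMaps n x P ≡ ∑[ f ∶ n ⟶ x ] 𝟙 (P f)
countMaps≡sumMaps zero    x P = refl
countMaps≡sumMaps (suc n) x P =
  trans (sum-map-tabulate (λ c → countMaps n x (P ∘ extend c)) id)
        (sum-cong-≗ (λ c → countMaps≡sumMaps n x (P ∘ extend c)))

module _ {x : ℕ} where

  sumMaps-cong : ∀ {n} {F G : (Fin n → Fin x) → ℕ} → (∀ f → F f ≡ G f) →
                 sumMaps n x F ≡ sumMaps n x G
  sumMaps-cong {zero}  F≗G = F≗G _
  sumMaps-cong {suc n} F≗G = sum-cong-≗ (λ c → sumMaps-cong (F≗G ∘ extend c))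

  sumMaps-zero : ∀ n → ∑[ f ∶ n ⟶ x ] 0 ≡ 0
  sumMaps-zero zero    = refl
  sumMaps-zero (suc n) = trans (sum-cong-≗ {x} (λ _ → sumMaps-zero n)) (sum-replicate-zero x)

  sumMaps-*ˡ : ∀ {n} k (F : (Fin n → Fin x) → ℕ) →
               ∑[ f ∶ n ⟶ x ] (k * F f) ≡ k * sumMaps n x F
  sumMaps-*ˡ {zero}  k F = refl
  sumMaps-*ˡ {suc n} k F = trans (sum-cong-≗ (λ c → sumMaps-*ˡ k (F ∘ extend c)))
                                 (sym (*-distribˡ-sum k (λ c → sumMaps n x (F ∘ extend c))))

  ∑-sumMaps-comm : ∀ {m n} (F : Fin m → (Fin n → Fin x) → ℕ) →
                   ∑[ c < m ] sumMaps n x (F c) ≡ ∑[ f ∶ n ⟶ x ] ∑[ c < m ] F c f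
  ∑-sumMaps-comm {n = zero}  F = refl
  ∑-sumMaps-comm {n = suc n} F = trans (∑-comm (λ c d → sumMaps n x (F c ∘ extend d)))
    (sum-cong-≗ (λ d → ∑-sumMaps-comm (λ c → F c ∘ extend d)))

sumMaps-*ʳ : ∀ {n x} (F : (Fin n → Fin x) → ℕ) k → ∑[ f ∶ n ⟶ x ] (F f * k) ≡ sumMaps n x F * k
sumMaps-*ʳ {n} F k = trans (sumMaps-cong {n = n} (λ f → *-comm (F f) k))
                           (trans (sumMaps-*ˡ k F) (*-comm k (sumMaps n _ F)))

sumMaps-comm : ∀ {n m x y} (F : (Fin n → Fin x) → (Fin m → Fin y) → ℕ) →
               ∑[ f ∶ n ⟶ x ] sumMaps m y (F f) ≡ ∑[ g ∶ m ⟶ y ] ∑[ f ∶ n ⟶ x ] F f g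
sumMaps-comm {zero}  F = refl
sumMaps-comm {suc n} {x = x} F = trans (sum-cong-≗ (λ c → sumMaps-comm (F ∘ extend c)))
  (∑-sumMaps-comm (λ c g → sumMaps n x (λ f → F (extend c f) g)))

-- Without function extensionality, reindexing a sum over maps needs a summand that respects
-- pointwise equality.
Extensional : ∀ {n x} → ((Fin n → Fin x) → ℕ) → Set
Extensional F = F Preserves _≗_ ⟶ _≡_

extend-cong : ∀ {n x} (c : Fin x) {f g : Fin n → Fin x} → f ≗ g → extend c f ≗ extend c g
extend-cong c f≗g zero    = refl
extend-cong c f≗g (suc i) = f≗g i

extend-++ : ∀ {n m x} (c : Fin x) (f : Fin n → Fin x) (g : Fin m → Fin x) →
            extend c (f ++ g) ≗ extend c f ++ g
extend-++ c f g zero = refl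
extend-++ {n} c f g (suc i) with splitAt n i
... | inj₁ _ = refl
... | inj₂ _ = refl

∘-++ : ∀ {n m x y} (ρ : Fin x → Fin y) (f : Fin n → Fin x) (g : Fin m → Fin x) →
       ρ ∘ (f ++ g) ≗ (ρ ∘ f) ++ (ρ ∘ g)
∘-++ {n} ρ f g i with splitAt n i
... | inj₁ _ = refl
... | inj₂ _ = refl

sumMaps-++ : ∀ {n m x} (F : (Fin (n + m) → Fin x) → ℕ) → Extensional F →
             sumMaps (n + m) x F ≡ ∑[ f ∶ n ⟶ x ] ∑[ g ∶ m ⟶ x ] F (f ++ g)
sumMaps-++ {zero}  F ext = refl
sumMaps-++ {suc n} {m} F ext = sum-cong-≗ λ c → trans
  (sumMaps-++ {n} {m} (F ∘ extend c) (ext ∘ extend-cong c))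
  (sumMaps-cong {n = n} λ f → sumMaps-cong {n = m} λ g → ext (extend-++ c f g))

sumMaps-permute : ∀ {n x} (π : Permutation′ x) (F : (Fin n → Fin x) → ℕ) → Extensional F →
                  ∑[ f ∶ n ⟶ x ] F ((π ⟨$⟩ʳ_) ∘ f) ≡ sumMaps n x F
sumMaps-permute {zero}  π F ext = ext (λ ())
sumMaps-permute {suc n} {x} π F ext = begin
  ∑[ c < x ] ∑[ f ∶ n ⟶ x ] F ((π ⟨$⟩ʳ_) ∘ extend c f)
    ≡⟨ sum-cong-≗ (λ c → sumMaps-cong λ f → ext (π-extend c f)) ⟩
  ∑[ c < x ] ∑[ f ∶ n ⟶ x ] F (extend (π ⟨$⟩ʳ c) ((π ⟨$⟩ʳ_) ∘ f))
    ≡⟨ sum-cong-≗ (λ c → sumMaps-permute π (F ∘ extend (π ⟨$⟩ʳ c)) (ext ∘ extend-cong _)) ⟩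
  ∑[ c < x ] sumMaps n x (F ∘ extend (π ⟨$⟩ʳ c))
    ≡⟨ ∑-permute (λ c → sumMaps n x (F ∘ extend c)) π ⟨
  ∑[ c < x ] sumMaps n x (F ∘ extend c)
    ∎
  where
  open ≡-Reasoning
  π-extend : ∀ c (f : Fin n → Fin x) → (π ⟨$⟩ʳ_) ∘ extend c f ≗ extend (π ⟨$⟩ʳ c) ((π ⟨$⟩ʳ_) ∘ f)
  π-extend c f zero    = refl
  π-extend c f (suc i) = refl

-- Counting tuples of distinct colours

module _ {x : ℕ} where

  fresh : ∀ {k} → Fin x → (Fin k → Fin x) → Bool
  fresh {zero}  c r = true
  fresh {suc k} c r = not ⌊ c ≟ r zero ⌋ ∧ fresh c (r ∘ suc)

  distinct : ∀ {k} → (Fin k → Fin x) → Bool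
  distinct {zero}  r = true
  distinct {suc k} r = fresh (r zero) (r ∘ suc) ∧ distinct (r ∘ suc)

  ∑-fresh : ∀ {k} (r : Fin k → Fin x) → distinct r ≡ true → ∑[ c < x ] 𝟙 (fresh c r) ≡ x ∸ k
  ∑-fresh {zero}  r _ = ∑-one x
  ∑-fresh {suc k} r dr = begin
    ∑[ c < x ] 𝟙 (not ⌊ c ≟ r zero ⌋ ∧ fresh c (r ∘ suc))
      ≡⟨ sum-cong-≗ (λ c → 𝟙-∧ (not ⌊ c ≟ r zero ⌋) (fresh c (r ∘ suc))) ⟩
    ∑[ c < x ] (𝟙 (not ⌊ c ≟ r zero ⌋) * 𝟙 (fresh c (r ∘ suc)))
      ≡⟨ ∑-avoid (r zero) (λ c → 𝟙 (fresh c (r ∘ suc))) ⟩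
    ∑[ c < x ] 𝟙 (fresh c (r ∘ suc)) ∸ 𝟙 (fresh (r zero) (r ∘ suc))
      ≡⟨ cong₂ _∸_ (∑-fresh (r ∘ suc) (proj₂ head-fresh)) (cong 𝟙 (proj₁ head-fresh)) ⟩
    x ∸ k ∸ 1
      ≡⟨ ∸-+-assoc x k 1 ⟩
    x ∸ (k + 1)
      ≡⟨ cong (x ∸_) (+-comm k 1) ⟩
    x ∸ suc k
      ∎
    where
    open ≡-Reasoning
    head-fresh : fresh (r zero) (r ∘ suc) ≡ true × distinct (r ∘ suc) ≡ true
    head-fresh = Equivalence.to ∧-≡-true dr

  sumMaps-distinct : ∀ k → ∑[ r ∶ k ⟶ x ] 𝟙 (distinct r) ≡ ff x k
  sumMaps-distinct zero    = refl
  sumMaps-distinct (suc k) = begin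
    ∑[ c < x ] ∑[ r ∶ k ⟶ x ] 𝟙 (fresh c r ∧ distinct r)
      ≡⟨ ∑-sumMaps-comm {x} (λ c (r : Fin k → Fin x) → 𝟙 (fresh c r ∧ distinct r)) ⟩
    ∑[ r ∶ k ⟶ x ] ∑[ c < x ] 𝟙 (fresh c r ∧ distinct r)
      ≡⟨ sumMaps-cong {x} {k} count-fresh ⟩
    ∑[ r ∶ k ⟶ x ] ((x ∸ k) * 𝟙 (distinct r))
      ≡⟨ sumMaps-*ˡ {x} {k} (x ∸ k) (𝟙 ∘ distinct) ⟩
    (x ∸ k) * sumMaps k x (𝟙 ∘ distinct)
      ≡⟨ cong ((x ∸ k) *_) (sumMaps-distinct k) ⟩
    (x ∸ k) * ff x k
      ≡⟨ *-comm (x ∸ k) (ff x k) ⟩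
    ff x (suc k)
      ∎
    where
    open ≡-Reasoning
    count-fresh : ∀ r → ∑[ c < x ] 𝟙 (fresh c r ∧ distinct r) ≡ (x ∸ k) * 𝟙 (distinct r)
    count-fresh r with distinct r in dr
    ... | true  = trans (sum-cong-≗ {x} (λ c → cong 𝟙 (∧-identityʳ (fresh c r))))
                        (trans (∑-fresh r dr) (sym (*-identityʳ (x ∸ k))))
    ... | false = trans (sum-cong-≗ {x} (λ c → cong 𝟙 (∧-zeroʳ (fresh c r))))
                        (trans (sum-replicate-zero x) (sym (*-zeroʳ (x ∸ k))))

-- Kernels and recolourings

SameKernel : ∀ {n x y} → (Fin n → Fin x) → (Fin n → Fin y) → Set
SameKernel h h' = ∀ u v → ⌊ h u ≟ h v ⌋ ≡ ⌊ h' u ≟ h' v ⌋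

≗⇒SameKernel : ∀ {n x} {h h' : Fin n → Fin x} → h ≗ h' → SameKernel h h'
≗⇒SameKernel h≗h' u v = cong₂ (λ a b → ⌊ a ≟ b ⌋) (h≗h' u) (h≗h' v)

injective-SameKernel : ∀ {n x y} {ρ : Fin x → Fin y} → Injective _≡_ _≡_ ρ →
                       (h : Fin n → Fin x) → SameKernel (ρ ∘ h) h
injective-SameKernel {ρ = ρ} ρ-inj h u v with h u ≟ h v
... | yes hu≡hv = ⌊≟⌋-true (cong ρ hu≡hv)
... | no hu≢hv  = ⌊≟⌋-false (hu≢hv ∘ ρ-inj)

SameKernel-≡ : ∀ {n x y} {h : Fin n → Fin x} {h' : Fin n → Fin y} → SameKernel h h' →
               ∀ {u v} → h u ≡ h v → h' u ≡ h' v
SameKernel-≡ K {u} {v} hu≡hv = ⌊≟⌋-sound (trans (sym (K u v)) (⌊≟⌋-true hu≡hv))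

isProper-kernel : ∀ n adj {x y} {h : Fin n → Fin x} {h' : Fin n → Fin y} → SameKernel h h' →
                  isProper n adj h ≡ isProper n adj h'
isProper-kernel n adj K = cong and (map-cong (λ u → cong and (map-cong (λ v →
  cong (λ b → not (adj u v ∧ b)) (K u v)) (allFin n))) (allFin n))

hasType-cong : ∀ t {n m x y} {c : Fin 4 → Fin n} {c' : Fin 4 → Fin m}
               {h : Fin n → Fin x} {h' : Fin m → Fin y} →
               ⌊ h (c 0F) ≟ h (c 2F) ⌋ ≡ ⌊ h' (c' 0F) ≟ h' (c' 2F) ⌋ →
               ⌊ h (c 1F) ≟ h (c 3F) ⌋ ≡ ⌊ h' (c' 1F) ≟ h' (c' 3F) ⌋ →
               hasType t c h ≡ hasType t c' h'
hasType-cong 0F e₀₂ e₁₃ = cong₂ (λ a b → a ∧ b) e₀₂ e₁₃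
hasType-cong 1F e₀₂ e₁₃ = cong₂ (λ a b → a ∧ not b) e₀₂ e₁₃
hasType-cong 2F e₀₂ e₁₃ = cong₂ (λ a b → not a ∧ b) e₀₂ e₁₃
hasType-cong 3F e₀₂ e₁₃ = cong₂ (λ a b → not a ∧ not b) e₀₂ e₁₃

hasType-≗ : ∀ t {n m x} {c : Fin 4 → Fin n} {c' : Fin 4 → Fin m}
            {h : Fin n → Fin x} {h' : Fin m → Fin x} →
            h ∘ c ≗ h' ∘ c' → hasType t c h ≡ hasType t c' h'
hasType-≗ t {c = c} {c'} {h} {h'} e = hasType-cong t {c = c} {c'} {h} {h'}
  (cong₂ (λ u v → ⌊ u ≟ v ⌋) (e 0F) (e 2F)) (cong₂ (λ u v → ⌊ u ≟ v ⌋) (e 1F) (e 3F))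

hasType-kernel : ∀ t {n x y} (c : Fin 4 → Fin n) {h : Fin n → Fin x} {h' : Fin n → Fin y} →
                 SameKernel h h' → hasType t c h ≡ hasType t c h'
hasType-kernel t c {h} {h'} K = hasType-cong t {c = c} {c} {h} {h'} (K _ _) (K _ _)

module _ {x : ℕ} where

  transpose-left : (i j : Fin x) → PC.transpose i j i ≡ j
  transpose-left i j rewrite dec-true (i ≟ i) refl = refl

  transpose-fixed : (i j : Fin x) {k : Fin x} → k ≢ i → k ≢ j → PC.transpose i j k ≡ k
  transpose-fixed i j {k} k≢i k≢j rewrite dec-false (k ≟ i) k≢i | dec-false (k ≟ j) k≢j = refl

  permutation-injective : (π : Permutation′ x) → Injective _≡_ _≡_ (π ⟨$⟩ʳ_)
  permutation-injective π {a} {b} πa≡πb =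
    trans (sym (Perm.inverseˡ π)) (trans (cong (π ⟨$⟩ˡ_) πa≡πb) (Perm.inverseˡ π))

  -- If q 0 is a new colour, compose the permutation found for the tail with the transposition
  -- taking π (q 0) to q' 0.
  kernel-permutation : ∀ {m} (q q' : Fin m → Fin x) → SameKernel q q' →
                       ∃[ π ] (π ⟨$⟩ʳ_) ∘ q ≗ q'
  kernel-permutation {zero}  q q' K = Perm.id , λ ()
  kernel-permutation {suc m} q q' K
    with kernel-permutation (q ∘ suc) (q' ∘ suc) (λ u v → K (suc u) (suc v))
       | any? (λ k → q zero ≟ q (suc k))
  ... | π , πq≗q' | yes (k , q₀≡qₖ) = π , λ where
    zero    → trans (cong (π ⟨$⟩ʳ_) q₀≡qₖ) (trans (πq≗q' k) (sym (SameKernel-≡ K q₀≡qₖ)))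
    (suc i) → πq≗q' i
  ... | π , πq≗q' | no q₀-new = π ∘ₚ Perm.transpose (π ⟨$⟩ʳ q zero) (q' zero) , λ where
    zero    → transpose-left (π ⟨$⟩ʳ q zero) (q' zero)
    (suc i) → trans (cong (PC.transpose _ _) (πq≗q' i))
      (transpose-fixed _ _
        (λ q'ᵢ≡πq₀ → q₀-new (i , permutation-injective π (sym (trans (πq≗q' i) q'ᵢ≡πq₀))))
        (λ q'ᵢ≡q'₀ → q₀-new (i , sym (SameKernel-≡ (λ u v → sym (K u v)) q'ᵢ≡q'₀))))

module _ {x : ℕ} where

  Proper : ∀ {n} → (Fin n → Fin n → Bool) → (Fin n → Fin x) → Set
  Proper adj h = ∀ u v → adj u v ≡ true → h u ≢ h v

  isProper⇔Proper : ∀ {n} adj (h : Fin n → Fin x) → isProper n adj h ≡ true ⇔ Proper adj h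
  isProper⇔Proper {n} adj h = mk⇔
    (λ proper u v uv → Equivalence.to not⌊≟⌋⇔≢ (edge-ok (Equivalence.to (all-allFin _)
       (Equivalence.to (all-allFin _) proper u) v) uv))
    (λ proper → Equivalence.from (all-allFin _) λ u → Equivalence.from (all-allFin _) λ v →
       edge-ok⁻ (λ uv → Equivalence.from not⌊≟⌋⇔≢ (proper u v uv)))
    where
    edge-ok : ∀ {a b} → not (a ∧ b) ≡ true → a ≡ true → not b ≡ true
    edge-ok {true} nb refl = nb
    edge-ok⁻ : ∀ {a b} → (a ≡ true → not b ≡ true) → not (a ∧ b) ≡ true
    edge-ok⁻ {true}  nb = nb refl
    edge-ok⁻ {false} _  = refl

  Proper-≗ : ∀ {n} {adj : Fin n → Fin n → Bool} {h h' : Fin n → Fin x} →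
             h ≗ h' → Proper adj h → Proper adj h'
  Proper-≗ h≗h' proper u v uv h'u≡h'v = proper u v uv (trans (h≗h' u) (trans h'u≡h'v (sym (h≗h' v))))

  Proper-pullback : ∀ {m n} {adj' : Fin m → Fin m → Bool} {adj : Fin n → Fin n → Bool}
                    (φ : Fin m → Fin n) → (∀ u v → adj' u v ≡ true → adj (φ u) (φ v) ≡ true) →
                    {h : Fin n → Fin x} → Proper adj h → Proper adj' (h ∘ φ)
  Proper-pullback φ φ-hom proper u v uv = proper (φ u) (φ v) (φ-hom u v uv)

EdgeImage : ∀ {m n} → (Fin m → Fin m → Bool) → (Fin m → Fin n) → Fin n → Fin n → Set
EdgeImage adj' φ u v = ∃[ u' ] ∃[ v' ] adj' u' v' ≡ true × φ u' ≡ u × φ v' ≡ v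

Proper-cover : ∀ {m₁ m₂ n x} {adj₁ : Fin m₁ → Fin m₁ → Bool} {adj₂ : Fin m₂ → Fin m₂ → Bool}
               {adj : Fin n → Fin n → Bool} {φ₁ : Fin m₁ → Fin n} {φ₂ : Fin m₂ → Fin n} →
               (∀ u v → adj u v ≡ true → EdgeImage adj₁ φ₁ u v ⊎ EdgeImage adj₂ φ₂ u v) →
               {h : Fin n → Fin x} → Proper adj₁ (h ∘ φ₁) → Proper adj₂ (h ∘ φ₂) → Proper adj h
Proper-cover cover proper₁ proper₂ u v uv with cover u v uv
... | inj₁ (u' , v' , e , refl , refl) = proper₁ u' v' e
... | inj₂ (u' , v' , e , refl , refl) = proper₂ u' v' e

-- Colourings of a 4-cycle

module _ {x : ℕ} where

  ProperCycle : (Fin 4 → Fin x) → Set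
  ProperCycle q = ∀ k → q k ≢ q (next k)

  isProperCycle : (Fin 4 → Fin x) → Bool
  isProperCycle q = all (λ k → not ⌊ q k ≟ q (next k) ⌋) (allFin 4)

  isProperCycle⇔ProperCycle : (q : Fin 4 → Fin x) → isProperCycle q ≡ true ⇔ ProperCycle q
  isProperCycle⇔ProperCycle q = mk⇔
    (λ cyc k → Equivalence.to not⌊≟⌋⇔≢ (Equivalence.to (all-allFin edge-ok) cyc k))
    (λ cyc → Equivalence.from (all-allFin edge-ok) (λ k → Equivalence.from not⌊≟⌋⇔≢ (cyc k)))
    where
    edge-ok : Fin 4 → Bool
    edge-ok k = not ⌊ q k ≟ q (next k) ⌋

typeBits : Fin 4 → Bool × Bool
typeBits 0F = true  , true
typeBits 1F = true  , false
typeBits 2F = false , true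
typeBits 3F = false , false

hasType-bits : ∀ t {x} (q : Fin 4 → Fin x) → hasType t id q ≡ true →
               (⌊ q 0F ≟ q 2F ⌋ , ⌊ q 1F ≟ q 3F ⌋) ≡ typeBits t
hasType-bits t q qt with ⌊ q 0F ≟ q 2F ⌋ | ⌊ q 1F ≟ q 3F ⌋
hasType-bits 0F q qt | true  | true  = refl
hasType-bits 0F q () | true  | false
hasType-bits 0F q () | false | _
hasType-bits 1F q qt | true  | false = refl
hasType-bits 1F q () | true  | true
hasType-bits 1F q () | false | _
hasType-bits 2F q qt | false | true  = refl
hasType-bits 2F q () | false | false
hasType-bits 2F q () | true  | _
hasType-bits 3F q qt | false | false = refl
hasType-bits 3F q () | false | true
hasType-bits 3F q () | true  | _

module _ {x : ℕ} where

  cycle-kernel : {q q' : Fin 4 → Fin x} → ProperCycle q → ProperCycle q' →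
                 (⌊ q 0F ≟ q 2F ⌋ , ⌊ q 1F ≟ q 3F ⌋) ≡ (⌊ q' 0F ≟ q' 2F ⌋ , ⌊ q' 1F ≟ q' 3F ⌋) →
                 SameKernel q q'
  cycle-kernel {q} {q'} cyc cyc' bits = kernel
    where
    diagonal : ∀ k → ⌊ q k ≟ q k ⌋ ≡ ⌊ q' k ≟ q' k ⌋
    diagonal k = trans (⌊≟⌋-true refl) (sym (⌊≟⌋-true refl))
    edge : ∀ k → ⌊ q k ≟ q (next k) ⌋ ≡ ⌊ q' k ≟ q' (next k) ⌋
    edge k = trans (⌊≟⌋-false (cyc k)) (sym (⌊≟⌋-false (cyc' k)))
    flip : ∀ {u v} → ⌊ q u ≟ q v ⌋ ≡ ⌊ q' u ≟ q' v ⌋ → ⌊ q v ≟ q u ⌋ ≡ ⌊ q' v ≟ q' u ⌋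
    flip {u} {v} e = trans (⌊≟⌋-sym (q v) (q u)) (trans e (⌊≟⌋-sym (q' u) (q' v)))
    kernel : SameKernel q q'
    kernel 0F 0F = diagonal 0F
    kernel 0F 1F = edge 0F
    kernel 0F 2F = cong proj₁ bits
    kernel 0F 3F = flip (edge 3F)
    kernel 1F 0F = flip (edge 0F)
    kernel 1F 1F = diagonal 1F
    kernel 1F 2F = edge 1F
    kernel 1F 3F = cong proj₂ bits
    kernel 2F 0F = flip (cong proj₁ bits)
    kernel 2F 1F = flip (edge 1F)
    kernel 2F 2F = diagonal 2F
    kernel 2F 3F = edge 2F
    kernel 3F 0F = edge 3F
    kernel 3F 1F = flip (cong proj₂ bits)
    kernel 3F 2F = flip (edge 2F)
    kernel 3F 3F = diagonal 3F

𝟙-split-by-type : ∀ b {m x} (c : Fin 4 → Fin m) (h : Fin m → Fin x) e →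
                  𝟙 b * e ≡ ∑[ j < 4 ] (𝟙 (b ∧ hasType j c h) * e)
𝟙-split-by-type false c h e = refl
𝟙-split-by-type true  c h e with ⌊ h (c 0F) ≟ h (c 2F) ⌋ | ⌊ h (c 1F) ≟ h (c 3F) ⌋
... | true  | true  = sym (+-identityʳ (1 * e))
... | true  | false = sym (+-identityʳ (1 * e))
... | false | true  = sym (+-identityʳ (1 * e))
... | false | false = sym (+-identityʳ (1 * e))

cycleCount : Fin 4 → ℕ → ℕ
cycleCount t x = ∑[ q ∶ 4 ⟶ x ] 𝟙 (isProperCycle q ∧ hasType t id q)

module _ {x : ℕ} where
  open ∧-Solver ∧-idempotentCommutativeMonoid using (solve; _⊜_; _⊕_) renaming (id to ⊤)

  properCycle-type₁ : ∀ (c₀ c₁ c₂ c₃ : Fin x) → let q = c₀ ∷ c₁ ∷ c₂ ∷ c₃ ∷ [] in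
    𝟙 (isProperCycle q ∧ hasType 0F id q) ≡ 𝟙 ⌊ c₂ ≟ c₀ ⌋ * (𝟙 ⌊ c₃ ≟ c₁ ⌋ * 𝟙 (distinct (c₀ ∷ c₁ ∷ [])))
  properCycle-type₁ c₀ c₁ c₂ c₃ with c₂ ≟ c₀ | c₃ ≟ c₁
  ... | yes refl | yes refl rewrite ⌊≟⌋-sym c₁ c₀ | ⌊≟⌋-true {a = c₀} refl | ⌊≟⌋-true {a = c₁} refl =
    trans (cong 𝟙 (solve 1 (λ a → (a ⊕ (a ⊕ (a ⊕ (a ⊕ ⊤)))) ⊕ (⊤ ⊕ ⊤) ⊜ (a ⊕ ⊤) ⊕ ⊤) refl (not ⌊ c₀ ≟ c₁ ⌋)))
          (sym (trans (*-identityˡ _) (*-identityˡ _)))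
  ... | yes refl | no c₃≢c₁ rewrite ⌊≟⌋-false (c₃≢c₁ ∘ sym) =
    𝟙-∧-false (isProperCycle (c₀ ∷ c₁ ∷ c₀ ∷ c₃ ∷ [])) ⌊ c₀ ≟ c₀ ⌋
  ... | no c₂≢c₀ | _        rewrite ⌊≟⌋-false (c₂≢c₀ ∘ sym) =
    cong 𝟙 (∧-zeroʳ (isProperCycle (c₀ ∷ c₁ ∷ c₂ ∷ c₃ ∷ [])))

  properCycle-type₂ : ∀ (c₀ c₁ c₂ c₃ : Fin x) → let q = c₀ ∷ c₁ ∷ c₂ ∷ c₃ ∷ [] in
    𝟙 (isProperCycle q ∧ hasType 1F id q) ≡ 𝟙 ⌊ c₂ ≟ c₀ ⌋ * 𝟙 (distinct (c₀ ∷ c₁ ∷ c₃ ∷ []))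
  properCycle-type₂ c₀ c₁ c₂ c₃ with c₂ ≟ c₀
  ... | yes refl rewrite ⌊≟⌋-sym c₁ c₀ | ⌊≟⌋-sym c₃ c₀ | ⌊≟⌋-true {a = c₀} refl =
    trans (cong 𝟙 (solve 3 (λ a b f → (a ⊕ (a ⊕ (b ⊕ (b ⊕ ⊤)))) ⊕ (⊤ ⊕ f) ⊜ (a ⊕ (b ⊕ ⊤)) ⊕ ((f ⊕ ⊤) ⊕ ⊤)) refl
                     (not ⌊ c₀ ≟ c₁ ⌋) (not ⌊ c₀ ≟ c₃ ⌋) (not ⌊ c₁ ≟ c₃ ⌋)))
          (sym (*-identityˡ _))
  ... | no c₂≢c₀ rewrite ⌊≟⌋-false (c₂≢c₀ ∘ sym) =
    cong 𝟙 (∧-zeroʳ (isProperCycle (c₀ ∷ c₁ ∷ c₂ ∷ c₃ ∷ [])))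

  properCycle-type₃ : ∀ (c₀ c₁ c₂ c₃ : Fin x) → let q = c₀ ∷ c₁ ∷ c₂ ∷ c₃ ∷ [] in
    𝟙 (isProperCycle q ∧ hasType 2F id q) ≡ 𝟙 ⌊ c₃ ≟ c₁ ⌋ * 𝟙 (distinct (c₀ ∷ c₁ ∷ c₂ ∷ []))
  properCycle-type₃ c₀ c₁ c₂ c₃ with c₃ ≟ c₁
  ... | yes refl rewrite ⌊≟⌋-sym c₂ c₁ | ⌊≟⌋-sym c₁ c₀ | ⌊≟⌋-true {a = c₁} refl =
    trans (cong 𝟙 (solve 3 (λ a b e → (a ⊕ (b ⊕ (b ⊕ (a ⊕ ⊤)))) ⊕ (e ⊕ ⊤) ⊜ (a ⊕ (e ⊕ ⊤)) ⊕ ((b ⊕ ⊤) ⊕ ⊤)) refl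
                     (not ⌊ c₀ ≟ c₁ ⌋) (not ⌊ c₁ ≟ c₂ ⌋) (not ⌊ c₀ ≟ c₂ ⌋)))
          (sym (*-identityˡ _))
  ... | no c₃≢c₁ rewrite ⌊≟⌋-false (c₃≢c₁ ∘ sym) =
    𝟙-∧-false (isProperCycle (c₀ ∷ c₁ ∷ c₂ ∷ c₃ ∷ [])) (not ⌊ c₀ ≟ c₂ ⌋)

  properCycle-type₄ : ∀ (q : Fin 4 → Fin x) → isProperCycle q ∧ hasType 3F id q ≡ distinct q
  properCycle-type₄ q rewrite ⌊≟⌋-sym (q 3F) (q 0F) =
    solve 6 (λ a b c d e f → (a ⊕ (b ⊕ (c ⊕ (d ⊕ ⊤)))) ⊕ (e ⊕ f)
                           ⊜ (a ⊕ (e ⊕ (d ⊕ ⊤))) ⊕ ((b ⊕ (f ⊕ ⊤)) ⊕ ((c ⊕ ⊤) ⊕ (⊤ ⊕ ⊤)))) refl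
      (not ⌊ q 0F ≟ q 1F ⌋) (not ⌊ q 1F ≟ q 2F ⌋) (not ⌊ q 2F ≟ q 3F ⌋)
      (not ⌊ q 0F ≟ q 3F ⌋) (not ⌊ q 0F ≟ q 2F ⌋) (not ⌊ q 1F ≟ q 3F ⌋)

cycleCount≡dd : ∀ t x → cycleCount t x ≡ dd t x
cycleCount≡dd 0F x = trans
  (sum-cong-≗ {x} λ c₀ → sum-cong-≗ {x} λ c₁ → begin
    ∑[ c₂ < x ] ∑[ c₃ < x ] 𝟙 (isProperCycle (c₀ ∷ c₁ ∷ c₂ ∷ c₃ ∷ []) ∧ hasType 0F id (c₀ ∷ c₁ ∷ c₂ ∷ c₃ ∷ []))
      ≡⟨ sum-cong-≗ (λ c₂ → sum-cong-≗ (properCycle-type₁ c₀ c₁ c₂)) ⟩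
    ∑[ c₂ < x ] ∑[ c₃ < x ] (𝟙 ⌊ c₂ ≟ c₀ ⌋ * (𝟙 ⌊ c₃ ≟ c₁ ⌋ * D c₀ c₁))
      ≡⟨ ∑∑-point c₀ (λ c₃ → 𝟙 ⌊ c₃ ≟ c₁ ⌋ * D c₀ c₁) ⟩
    ∑[ c₃ < x ] (𝟙 ⌊ c₃ ≟ c₁ ⌋ * D c₀ c₁)
      ≡⟨ ∑-point c₁ (λ _ → D c₀ c₁) ⟩
    D c₀ c₁ ∎)
  (sumMaps-distinct {x} 2)
  where
  open ≡-Reasoning
  D : Fin x → Fin x → ℕ
  D c₀ c₁ = 𝟙 (distinct (c₀ ∷ c₁ ∷ []))
cycleCount≡dd 1F x = trans
  (sum-cong-≗ {x} λ c₀ → sum-cong-≗ {x} λ c₁ → trans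
    (sum-cong-≗ (λ c₂ → sum-cong-≗ (properCycle-type₂ c₀ c₁ c₂)))
    (∑∑-point c₀ (λ c₃ → 𝟙 (distinct (c₀ ∷ c₁ ∷ c₃ ∷ [])))))
  (sumMaps-distinct {x} 3)
cycleCount≡dd 2F x = trans
  (sum-cong-≗ {x} λ c₀ → sum-cong-≗ {x} λ c₁ → sum-cong-≗ λ c₂ → trans
    (sum-cong-≗ (properCycle-type₃ c₀ c₁ c₂))
    (∑-point c₁ (λ _ → 𝟙 (distinct (c₀ ∷ c₁ ∷ c₂ ∷ [])))))
  (sumMaps-distinct {x} 3)
cycleCount≡dd 3F x = trans (sumMaps-cong {x} (cong 𝟙 ∘ properCycle-type₄)) (sumMaps-distinct {x} 4)

adjL-inner : ∀ k → adjL (pL k) (pL (next k)) ≡ true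
adjL-inner 0F = refl
adjL-inner 1F = refl
adjL-inner 2F = refl
adjL-inner 3F = refl

glue-++ : ∀ {n x} (a : Fin 4 → Fin n) (f : Fin n → Fin x) (g : Fin 4 → Fin x) →
          (f ++ g) ∘ glue a ≗ g ++ (f ∘ a)
glue-++ a f g l with splitAt 4 l
... | inj₁ i = lookup-++ʳ f g i
... | inj₂ i = lookup-++ˡ f g (a i)

pairs8 : List (Fin 8 × Fin 8)
pairs8 = concatMap (λ l → map (λ l' → (l , l')) (allFin 8)) (allFin 8)

∈-pairs8 : ∀ l l' → (l , l') ∈ pairs8
∈-pairs8 l l' = ∈-concatMap⁺ (λ l → map (l ,_) (allFin 8)) (lose (∈-allFin l) (∈-map⁺ (l ,_) (∈-allFin l')))

module _ {n : ℕ} (adj : Fin n → Fin n → Bool) (a : Fin 4 → Fin n) where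

  -- The two disjuncts of adjA', which are local to its definition.
  edgeFromA : Fin n ⊎ Fin 4 → Fin n ⊎ Fin 4 → Bool
  edgeFromA (inj₁ u) (inj₁ v) = adj u v
  edgeFromA _        _        = false

  gluedEdge : Fin (n + 4) → Fin (n + 4) → Fin 8 × Fin 8 → Bool
  gluedEdge u v (l , l') = adjL l l' ∧ ⌊ glue a l ≟ u ⌋ ∧ ⌊ glue a l' ≟ v ⌋

  adjA'-split : ∀ u v → adjA' n adj a u v ≡ edgeFromA (splitAt n u) (splitAt n v) ∨ any (gluedEdge u v) pairs8
  adjA'-split u v with splitAt n u | splitAt n v
  ... | inj₁ _ | inj₁ _ = refl
  ... | inj₁ _ | inj₂ _ = refl
  ... | inj₂ _ | inj₁ _ = refl
  ... | inj₂ _ | inj₂ _ = refl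

  adjA'-fromA : ∀ u v → adj u v ≡ true → adjA' n adj a (u ↑ˡ 4) (v ↑ˡ 4) ≡ true
  adjA'-fromA u v uv rewrite splitAt-↑ˡ n u 4 | splitAt-↑ˡ n v 4 | uv = refl

  adjA'-fromL : ∀ l l' → adjL l l' ≡ true → adjA' n adj a (glue a l) (glue a l') ≡ true
  adjA'-fromL l l' ll' = trans (adjA'-split (glue a l) (glue a l'))
    (Equivalence.from (∨-≡-true {edgeFromA (splitAt n (glue a l)) (splitAt n (glue a l'))}) (inj₂ glued))
    where
    edge : gluedEdge (glue a l) (glue a l') (l , l') ≡ true
    edge rewrite ll' | ⌊≟⌋-true {a = glue a l} refl | ⌊≟⌋-true {a = glue a l'} refl = refl
    glued : any (gluedEdge (glue a l) (glue a l')) pairs8 ≡ true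
    glued = Equivalence.to T-≡ (any⁺ (gluedEdge (glue a l) (glue a l'))
                                     (lose (∈-pairs8 l l') (Equivalence.from T-≡ edge)))

  adjA'-cover : ∀ u v → adjA' n adj a u v ≡ true →
                EdgeImage adj (_↑ˡ 4) u v ⊎ EdgeImage adjL (glue a) u v
  adjA'-cover u v uv with Equivalence.to ∨-≡-true (trans (sym (adjA'-split u v)) uv)
  ... | inj₁ fromA = inj₁ (fromA-image (splitAt n u) (splitAt n v) refl refl fromA)
    where
    fromA-image : ∀ s t → splitAt n u ≡ s → splitAt n v ≡ t → edgeFromA s t ≡ true → EdgeImage adj (_↑ˡ 4) u v
    fromA-image (inj₁ u') (inj₁ v') su sv e = u' , v' , e , splitAt⁻¹-↑ˡ su , splitAt⁻¹-↑ˡ sv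
  ... | inj₂ fromL with satisfied (any⁻ (gluedEdge u v) pairs8 (Equivalence.from T-≡ fromL))
  ...   | (l , l') , glued = let adj-ll' , rest = Equivalence.to ∧-≡-true (Equivalence.to T-≡ glued)
                                 gl , gl' = Equivalence.to ∧-≡-true rest
                             in inj₂ (l , l' , adj-ll' , ⌊≟⌋-sound gl , ⌊≟⌋-sound gl')

  isProper-A' : ∀ {x} (f : Fin n → Fin x) (g : Fin 4 → Fin x) →
                isProper (n + 4) (adjA' n adj a) (f ++ g) ≡ isProper n adj f ∧ isProper 8 adjL (g ++ (f ∘ a))
  isProper-A' f g = ⇔→≡ (mk⇔
    (λ proper → Equivalence.from ∧-≡-true
      ( Equivalence.from (isProper⇔Proper adj f)
          (Proper-≗ (lookup-++ˡ f g) (Proper-pullback (_↑ˡ 4) adjA'-fromA (toProper proper)))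
      , Equivalence.from (isProper⇔Proper adjL (g ++ (f ∘ a)))
          (Proper-≗ (glue-++ a f g) (Proper-pullback (glue a) adjA'-fromL (toProper proper)))))
    (λ proper → let properA , properL = Equivalence.to (∧-≡-true {isProper n adj f}) proper in
      Equivalence.from (isProper⇔Proper (adjA' n adj a) (f ++ g)) (Proper-cover adjA'-cover
        (Proper-≗ (sym ∘ lookup-++ˡ f g) (Equivalence.to (isProper⇔Proper adj f) properA))
        (Proper-≗ (sym ∘ glue-++ a f g) (Equivalence.to (isProper⇔Proper adjL (g ++ (f ∘ a))) properL)))))
    where
    toProper : isProper (n + 4) (adjA' n adj a) (f ++ g) ≡ true → Proper (adjA' n adj a) (f ++ g)
    toProper = Equivalence.to (isProper⇔Proper (adjA' n adj a) (f ++ g))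

-- Extending a colouring of the inner cycle across L

module _ {x : ℕ} where

  extends : Fin 4 → (Fin 4 → Fin x) → (Fin 4 → Fin x) → Bool
  extends i q g = isProper 8 adjL (g ++ q) ∧ hasType i id g

  extensions : Fin 4 → (Fin 4 → Fin x) → ℕ
  extensions i q = ∑[ g ∶ 4 ⟶ x ] 𝟙 (extends i q g)

  extends-kernel : ∀ i {q q' g g' : Fin 4 → Fin x} →
                   SameKernel (g ++ q) (g' ++ q') → SameKernel g g' → extends i q g ≡ extends i q' g'
  extends-kernel i K K' = cong₂ _∧_ (isProper-kernel 8 adjL K) (hasType-kernel i id K')

  extensions-cong : ∀ i {q q'} → q ≗ q' → extensions i q ≡ extensions i q'
  extensions-cong i {q} q≗q' = sumMaps-cong {n = 4} λ g → cong 𝟙 (extends-kernel i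
    (≗⇒SameKernel (++-cong g g (λ _ → refl) q≗q')) (≗⇒SameKernel (λ _ → refl)))

  extensions-permute : ∀ i (π : Permutation′ x) q → extensions i ((π ⟨$⟩ʳ_) ∘ q) ≡ extensions i q
  extensions-permute i π q = trans
    (sym (sumMaps-permute π (𝟙 ∘ extends i πq) λ {g} {g'} g≗g' → cong 𝟙 (extends-kernel i {πq} {πq}
      (≗⇒SameKernel (++-cong g g' g≗g' (λ _ → refl))) (≗⇒SameKernel g≗g'))))
    (sumMaps-cong {n = 4} λ g → cong 𝟙 (extends-kernel i
      (λ u v → trans (sym (≗⇒SameKernel (∘-++ (π ⟨$⟩ʳ_) g q) u v))
                     (injective-SameKernel (permutation-injective π) (g ++ q) u v))
      (injective-SameKernel (permutation-injective π) g)))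
    where
    πq : Fin 4 → Fin x
    πq = (π ⟨$⟩ʳ_) ∘ q

  extensions-invariant : ∀ i j {q q' : Fin 4 → Fin x} →
                         isProperCycle q ≡ true → isProperCycle q' ≡ true →
                         hasType j id q ≡ true → hasType j id q' ≡ true →
                         extensions i q ≡ extensions i q'
  extensions-invariant i j {q} {q'} cyc cyc' qj q'j =
    let π , πq≗q' = kernel-permutation q q' (cycle-kernel
                      (Equivalence.to (isProperCycle⇔ProperCycle q) cyc)
                      (Equivalence.to (isProperCycle⇔ProperCycle q') cyc')
                      (trans (hasType-bits j q qj) (sym (hasType-bits j q' q'j))))
    in trans (sym (extensions-permute i π q)) (extensions-cong i πq≗q')

  properL⇒properCycle : (g q : Fin 4 → Fin x) → isProper 8 adjL (g ++ q) ≡ true → isProperCycle q ≡ true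
  properL⇒properCycle g q proper = Equivalence.from (isProperCycle⇔ProperCycle q) λ k qₖ≡qₖ₊₁ →
    Equivalence.to (isProper⇔Proper adjL (g ++ q)) proper (pL k) (pL (next k)) (adjL-inner k)
      (trans (lookup-++ʳ g q k) (trans qₖ≡qₖ₊₁ (sym (lookup-++ʳ g q (next k)))))

  extensions-properCycle : ∀ i q → 𝟙 (isProperCycle q) * extensions i q ≡ extensions i q
  extensions-properCycle i q with isProperCycle q in cyc
  ... | true  = *-identityˡ (extensions i q)
  ... | false = sym (trans (sumMaps-cong {n = 4} (cong 𝟙 ∘ no-extension)) (sumMaps-zero {x = x} 4))
    where
    no-extension : ∀ g → extends i q g ≡ false
    no-extension g with isProper 8 adjL (g ++ q) in proper
    ... | true  = contradiction (trans (sym (properL⇒properCycle g q proper)) cyc) λ ()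
    ... | false = refl

M≡∑extensions : ∀ x i j → M x i j ≡ ∑[ q ∶ 4 ⟶ x ] (𝟙 (isProperCycle q ∧ hasType j id q) * extensions i q)
M≡∑extensions x i j = begin
  M x i j
    ≡⟨ countMaps≡sumMaps 8 x M-summand ⟩
  ∑[ h ∶ 8 ⟶ x ] 𝟙 (M-summand h)
    ≡⟨ sumMaps-++ {4} {4} (𝟙 ∘ M-summand) (λ {h} {h'} h≗h' → cong 𝟙 (M-summand-kernel (≗⇒SameKernel h≗h'))) ⟩
  ∑[ g ∶ 4 ⟶ x ] ∑[ q ∶ 4 ⟶ x ] 𝟙 (M-summand (g ++ q))
    ≡⟨ sumMaps-cong {x = x} {n = 4} (λ g → sumMaps-cong {x = x} {n = 4} λ q → cong 𝟙 (split-types g q)) ⟩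
  ∑[ g ∶ 4 ⟶ x ] ∑[ q ∶ 4 ⟶ x ] 𝟙 (M-summand++ g q)
    ≡⟨ sumMaps-comm (λ g q → 𝟙 (M-summand++ g q)) ⟩
  ∑[ q ∶ 4 ⟶ x ] ∑[ g ∶ 4 ⟶ x ] 𝟙 (M-summand++ g q)
    ≡⟨ sumMaps-cong {x = x} {n = 4} (λ q → trans
         (sumMaps-cong {x = x} {n = 4} λ g →
           𝟙-∧-swap (isProper 8 adjL (g ++ q)) (hasType i id g) (hasType j id q))
         (sumMaps-*ˡ (𝟙 (hasType j id q)) (𝟙 ∘ extends i q))) ⟩
  ∑[ q ∶ 4 ⟶ x ] (𝟙 (hasType j id q) * extensions i q)
    ≡⟨ sumMaps-cong {x = x} {n = 4} (λ q → sym (only-proper-cycles q)) ⟩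
  ∑[ q ∶ 4 ⟶ x ] (𝟙 (isProperCycle q ∧ hasType j id q) * extensions i q)
    ∎
  where
  open ≡-Reasoning
  M-summand : (Fin 8 → Fin x) → Bool
  M-summand h = isProper 8 adjL h ∧ hasType i oL h ∧ hasType j pL h
  M-summand++ : (Fin 4 → Fin x) → (Fin 4 → Fin x) → Bool
  M-summand++ g q = isProper 8 adjL (g ++ q) ∧ hasType i id g ∧ hasType j id q
  M-summand-kernel : {h h' : Fin 8 → Fin x} → SameKernel h h' → M-summand h ≡ M-summand h'
  M-summand-kernel K = cong₂ _∧_ (isProper-kernel 8 adjL K)
                           (cong₂ _∧_ (hasType-kernel i oL K) (hasType-kernel j pL K))
  split-types : ∀ g q → M-summand (g ++ q) ≡ M-summand++ g q
  split-types g q = cong (isProper 8 adjL (g ++ q) ∧_)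
    (cong₂ _∧_ (hasType-≗ i {c = oL} {id} {g ++ q} (lookup-++ˡ g q))
               (hasType-≗ j {c = pL} {id} {g ++ q} (lookup-++ʳ g q)))
  only-proper-cycles : ∀ q → 𝟙 (isProperCycle q ∧ hasType j id q) * extensions i q
                           ≡ 𝟙 (hasType j id q) * extensions i q
  only-proper-cycles q = begin
    𝟙 (isProperCycle q ∧ hasType j id q) * extensions i q
      ≡⟨ cong (_* extensions i q) (𝟙-∧ (isProperCycle q) (hasType j id q)) ⟩
    𝟙 (isProperCycle q) * 𝟙 (hasType j id q) * extensions i q
      ≡⟨ cong (_* extensions i q) (*-comm (𝟙 (isProperCycle q)) (𝟙 (hasType j id q))) ⟩
    𝟙 (hasType j id q) * 𝟙 (isProperCycle q) * extensions i q
      ≡⟨ *-assoc (𝟙 (hasType j id q)) (𝟙 (isProperCycle q)) (extensions i q) ⟩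
    𝟙 (hasType j id q) * (𝟙 (isProperCycle q) * extensions i q)
      ≡⟨ cong (𝟙 (hasType j id q) *_) (extensions-properCycle i q) ⟩
    𝟙 (hasType j id q) * extensions i q
      ∎

properA⇒properCycle : ∀ {n x} (adj : Fin n → Fin n → Bool) (a : Fin 4 → Fin n) →
                      (∀ k → adj (a k) (a (next k)) ≡ true) →
                      (f : Fin n → Fin x) → isProper n adj f ≡ true → isProperCycle (f ∘ a) ≡ true
properA⇒properCycle adj a a-cycle f proper = Equivalence.from (isProperCycle⇔ProperCycle (f ∘ a))
  λ k → Equivalence.to (isProper⇔Proper adj f) proper (a k) (a (next k)) (a-cycle k)

ddAll≡ddOther*dd : ∀ j x → ddAll x ≡ ddOther j x * dd j x
ddAll≡ddOther*dd 0F x = rotate (dd 0F x) (dd 1F x) (dd 2F x) (dd 3F x)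
  where
  rotate : ∀ a b c d → a * b * c * d ≡ b * c * d * a
  rotate = solve-∀
ddAll≡ddOther*dd 1F x = rotate (dd 0F x) (dd 1F x) (dd 2F x) (dd 3F x)
  where
  rotate : ∀ a b c d → a * b * c * d ≡ a * c * d * b
  rotate = solve-∀
ddAll≡ddOther*dd 2F x = rotate (dd 0F x) (dd 1F x) (dd 2F x) (dd 3F x)
  where
  rotate : ∀ a b c d → a * b * c * d ≡ a * b * d * c
  rotate = solve-∀
ddAll≡ddOther*dd 3F x = refl

module Gluing {n : ℕ} (adj : Fin n → Fin n → Bool) (a : Fin 4 → Fin n)
              (a-cycle : ∀ k → adj (a k) (a (next k)) ≡ true) (x : ℕ) (i : Fin 4) where

  countByInnerType : Fin 4 → ℕ
  countByInnerType j = ∑[ f ∶ n ⟶ x ] (𝟙 (isProper n adj f ∧ hasType j a f) * extensions i (f ∘ a))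

  P-A'≡∑countByInnerType : P (n + 4) (adjA' n adj a) (cycA' n) x i ≡ ∑[ j < 4 ] countByInnerType j
  P-A'≡∑countByInnerType = begin
    P (n + 4) (adjA' n adj a) (cycA' n) x i
      ≡⟨ countMaps≡sumMaps (n + 4) x P-summand ⟩
    ∑[ h ∶ n + 4 ⟶ x ] 𝟙 (P-summand h)
      ≡⟨ sumMaps-++ {n} {4} (𝟙 ∘ P-summand) (λ {h} {h'} h≗h' → cong 𝟙 (P-summand-kernel (≗⇒SameKernel h≗h'))) ⟩
    ∑[ f ∶ n ⟶ x ] ∑[ g ∶ 4 ⟶ x ] 𝟙 (P-summand (f ++ g))
      ≡⟨ sumMaps-cong {x = x} {n = n} (λ f → trans (sumMaps-cong {x = x} {n = 4} (split-P-summand f))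
                                                   (sumMaps-*ˡ (𝟙 (isProper n adj f)) (𝟙 ∘ extends i (f ∘ a)))) ⟩
    ∑[ f ∶ n ⟶ x ] (𝟙 (isProper n adj f) * extensions i (f ∘ a))
      ≡⟨ sumMaps-cong {x = x} {n = n} (λ f → 𝟙-split-by-type (isProper n adj f) a f (extensions i (f ∘ a))) ⟩
    ∑[ f ∶ n ⟶ x ] ∑[ j < 4 ] (𝟙 (isProper n adj f ∧ hasType j a f) * extensions i (f ∘ a))
      ≡⟨ ∑-sumMaps-comm (λ j f → 𝟙 (isProper n adj f ∧ hasType j a f) * extensions i (f ∘ a)) ⟨
    ∑[ j < 4 ] countByInnerType j
      ∎
    where
    open ≡-Reasoning
    P-summand : (Fin (n + 4) → Fin x) → Bool
    P-summand h = isProper (n + 4) (adjA' n adj a) h ∧ hasType i (cycA' n) h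
    P-summand-kernel : {h h' : Fin (n + 4) → Fin x} → SameKernel h h' → P-summand h ≡ P-summand h'
    P-summand-kernel K = cong₂ _∧_ (isProper-kernel (n + 4) (adjA' n adj a) K) (hasType-kernel i (cycA' n) K)
    split-P-summand : ∀ f g → 𝟙 (P-summand (f ++ g)) ≡ 𝟙 (isProper n adj f) * 𝟙 (extends i (f ∘ a) g)
    split-P-summand f g = trans
      (cong 𝟙 (cong₂ _∧_ (isProper-A' adj a f g) (hasType-≗ i {c = cycA' n} {id} {f ++ g} (lookup-++ʳ f g))))
      (𝟙-∧-assoc (isProper n adj f) (isProper 8 adjL (g ++ (f ∘ a))) (hasType i id g))

  dd*countByInnerType≡M*P : ∀ j → dd j x * countByInnerType j ≡ M x i j * P n adj a x j
  dd*countByInnerType≡M*P j = begin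
    dd j x * countByInnerType j
      ≡⟨ cong (_* countByInnerType j) (cycleCount≡dd j x) ⟨
    cycleCount j x * countByInnerType j
      ≡⟨ sumMaps-*ʳ (𝟙 ∘ C) (countByInnerType j) ⟨
    ∑[ q ∶ 4 ⟶ x ] (𝟙 (C q) * countByInnerType j)
      ≡⟨ sumMaps-cong {x = x} {n = 4} (λ q → sumMaps-*ˡ (𝟙 (C q)) (λ f → 𝟙 (Aj f) * extensions i (f ∘ a))) ⟨
    ∑[ q ∶ 4 ⟶ x ] ∑[ f ∶ n ⟶ x ] (𝟙 (C q) * (𝟙 (Aj f) * extensions i (f ∘ a)))
      ≡⟨ sumMaps-cong {x = x} {n = 4} (λ q → sumMaps-cong {x = x} {n = n} λ f →
           𝟙-exchange (C q) (Aj f) (same-extensions q f)) ⟩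
    ∑[ q ∶ 4 ⟶ x ] ∑[ f ∶ n ⟶ x ] (𝟙 (C q) * extensions i q * 𝟙 (Aj f))
      ≡⟨ sumMaps-cong {x = x} {n = 4} (λ q → sumMaps-*ˡ (𝟙 (C q) * extensions i q) (𝟙 ∘ Aj)) ⟩
    ∑[ q ∶ 4 ⟶ x ] (𝟙 (C q) * extensions i q * sumMaps n x (𝟙 ∘ Aj))
      ≡⟨ sumMaps-*ʳ (λ q → 𝟙 (C q) * extensions i q) (sumMaps n x (𝟙 ∘ Aj)) ⟩
    ∑[ q ∶ 4 ⟶ x ] (𝟙 (C q) * extensions i q) * sumMaps n x (𝟙 ∘ Aj)
      ≡⟨ cong₂ _*_ (M≡∑extensions x i j) (countMaps≡sumMaps n x Aj) ⟨
    M x i j * P n adj a x j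
      ∎
    where
    open ≡-Reasoning
    C : (Fin 4 → Fin x) → Bool
    C q = isProperCycle q ∧ hasType j id q
    Aj : (Fin n → Fin x) → Bool
    Aj f = isProper n adj f ∧ hasType j a f
    same-extensions : ∀ q f → C q ≡ true → Aj f ≡ true → extensions i (f ∘ a) ≡ extensions i q
    same-extensions q f Cq Aj-f =
      let cyc , qj = Equivalence.to (∧-≡-true {isProperCycle q}) Cq
          proper , fj = Equivalence.to (∧-≡-true {isProper n adj f}) Aj-f
      in extensions-invariant i j {f ∘ a} {q} (properA⇒properCycle adj a a-cycle f proper) cyc
           (trans (hasType-≗ j {c = id} {a} {f ∘ a} {f} (λ _ → refl)) fj) qj

  ddAll*countByInnerType≡M*ddOther*P : ∀ j → ddAll x * countByInnerType j ≡ M x i j * ddOther j x * P n adj a x j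
  ddAll*countByInnerType≡M*ddOther*P j = begin
    ddAll x * countByInnerType j                 ≡⟨ cong (_* countByInnerType j) (ddAll≡ddOther*dd j x) ⟩
    ddOther j x * dd j x * countByInnerType j    ≡⟨ *-assoc (ddOther j x) (dd j x) (countByInnerType j) ⟩
    ddOther j x * (dd j x * countByInnerType j)  ≡⟨ cong (ddOther j x *_) (dd*countByInnerType≡M*P j) ⟩
    ddOther j x * (M x i j * P n adj a x j)      ≡⟨ swap (ddOther j x) (M x i j) (P n adj a x j) ⟩
    M x i j * ddOther j x * P n adj a x j        ∎
    where
    open ≡-Reasoning
    swap : ∀ d m p → d * (m * p) ≡ m * d * p
    swap = solve-∀

mainTheorem2 : (n : ℕ) (adj : Fin n → Fin n → Bool) →
    (∀ u v → adj u v ≡ adj v u) → (∀ u → adj u u ≡ false) →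
    (a : Fin 4 → Fin n) → Injective _≡_ _≡_ a →
    (∀ i → adj (a i) (a (next i)) ≡ true) →
    (x : ℕ) (i : Fin 4) →
    ddAll x * P (n + 4) (adjA' n adj a) (cycA' n) x i
      ≡ sum (map (λ j → M x i j * ddOther j x * P n adj a x j) (allFin 4))
mainTheorem2 n adj _ _ a _ a-cycle x i = begin
  ddAll x * P (n + 4) (adjA' n adj a) (cycA' n) x i
    ≡⟨ cong (ddAll x *_) P-A'≡∑countByInnerType ⟩
  ddAll x * ∑[ j < 4 ] countByInnerType j
    ≡⟨ *-distribˡ-sum (ddAll x) countByInnerType ⟩
  ∑[ j < 4 ] (ddAll x * countByInnerType j)
    ≡⟨ sum-cong-≗ ddAll*countByInnerType≡M*ddOther*P ⟩
  ∑[ j < 4 ] (M x i j * ddOther j x * P n adj a x j)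
    ≡⟨ sum-map-tabulate (λ j → M x i j * ddOther j x * P n adj a x j) id ⟨
  sum (map (λ j → M x i j * ddOther j x * P n adj a x j) (allFin 4))
    ∎
  where
  open ≡-Reasoning
  open Gluing adj a a-cycle x i
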